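{- There exist two sequences $A=(a_0,\dots,a_{49})$ and $B=(b_0,\dots,b_{49})$ with all $a_j,b_j\in\{1,-1\}$ such that for every $i$ with $1\le i\le 49$, $$\sum_{j=0}^{49} a_j a_{i+j}+\sum_{j=0}^{49} b_j b_{i+j}=0,$$ where the indices $i+j$ are reduced modulo $50$.
   Context: For a $\pm1$ sequence $(a_0,\dots,a_{v-1})$, its periodic autocorrelation function is $\tilde\phi(i)=\sum_{j=0}^{v-1}a_ja_{i+j}$ ($0\le i<v$, indices modulo $v$). The claim asserts the existence of a pair of binary sequences of length $50$ whose periodic autocorrelation functions sum to zero at all nonzero shifts. -}

module Defs where

open import Data.Nat using (ℕ; suc; _+_; NonZero)
open import Data.Nat.DivMod using (_%_; m%n<n)
open import Data.Fin using (Fin; toℕ; fromℕ<)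
open import Data.Integer using (ℤ; +_; -_) renaming (_*_ to _*ℤ_; _+_ to _+ℤ_)
open import Data.Sum using (_⊎_)
open import Relation.Binary.PropositionalEquality using (_≡_)

sumTo : ℕ → (ℕ → ℤ) → ℤ
sumTo 0       f = + 0
sumTo (suc n) f = sumTo n f +ℤ f n

IsPM1 : {v : ℕ} → (Fin v → ℤ) → Set
IsPM1 a = ∀ j → (a j ≡ + 1) ⊎ (a j ≡ - (+ 1))

_at_ : {v : ℕ} .{{_ : NonZero v}} → (Fin v → ℤ) → ℕ → ℤ
_at_ {v} a k = a (fromℕ< (m%n<n k v))

paf : {v : ℕ} .{{_ : NonZero v}} → (Fin v → ℤ) → ℕ → ℤ
paf {v} a i = sumTo v (λ j → (a at j) *ℤ (a at (i + j)))

-- The pair is an explicit witness from a computer search. Encoding the sequences by signs makes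
-- the ±1 condition hold by construction, and the 49 autocorrelation identities are decided by
-- evaluation.
module Submission where

open import Defs
open import Data.Nat using (ℕ; suc; _≤_; _<_)
open import Data.Fin using (Fin; toℕ; fromℕ<)
open import Data.Fin.Properties using (toℕ-fromℕ<; all?)
open import Data.Integer using (ℤ; +_; _◃_) renaming (_+_ to _+ℤ_)
open import Data.Integer.Properties using (_≟_)
open import Data.Sign using (Sign) renaming (+ to ⊕; - to ⊖)
open import Data.Vec using (Vec; _∷_; []; lookup)
open import Data.Product using (Σ; _×_; _,_)
open import Data.Sum using (inj₁; inj₂)
open import Relation.Nullary.Decidable using (Dec; toWitness)
open import Relation.Binary.PropositionalEquality using (_≡_; refl; subst)

fromSigns : {v : ℕ} → Vec Sign v → Fin v → ℤ
fromSigns s j = lookup s j ◃ 1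

fromSigns-isPM1 : {v : ℕ} (s : Vec Sign v) → IsPM1 (fromSigns s)
fromSigns-isPM1 s j with lookup s j
... | ⊕ = inj₁ refl
... | ⊖ = inj₂ refl

fromFin-< : {n : ℕ} (P : ℕ → Set) → ((k : Fin n) → P (toℕ k)) → {i : ℕ} → i < n → P i
fromFin-< P all-P i<n = subst P (toℕ-fromℕ< i<n) (all-P (fromℕ< i<n))

signsA signsB : Vec Sign 50
signsA = ⊖ ∷ ⊕ ∷ ⊖ ∷ ⊖ ∷ ⊕ ∷ ⊖ ∷ ⊕ ∷ ⊖ ∷ ⊖ ∷ ⊕ ∷ ⊕ ∷ ⊖ ∷ ⊖ ∷ ⊖ ∷ ⊕ ∷ ⊖ ∷ ⊕ ∷ ⊕ ∷ ⊕ ∷ ⊖ ∷ ⊖ ∷ ⊖ ∷ ⊖ ∷ ⊕ ∷ ⊖ ∷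
         ⊖ ∷ ⊕ ∷ ⊖ ∷ ⊖ ∷ ⊕ ∷ ⊖ ∷ ⊖ ∷ ⊖ ∷ ⊕ ∷ ⊖ ∷ ⊕ ∷ ⊖ ∷ ⊕ ∷ ⊕ ∷ ⊖ ∷ ⊕ ∷ ⊕ ∷ ⊕ ∷ ⊖ ∷ ⊕ ∷ ⊖ ∷ ⊕ ∷ ⊖ ∷ ⊖ ∷ ⊖ ∷ []
signsB = ⊕ ∷ ⊕ ∷ ⊖ ∷ ⊕ ∷ ⊕ ∷ ⊕ ∷ ⊖ ∷ ⊕ ∷ ⊖ ∷ ⊖ ∷ ⊕ ∷ ⊕ ∷ ⊕ ∷ ⊕ ∷ ⊖ ∷ ⊕ ∷ ⊖ ∷ ⊕ ∷ ⊕ ∷ ⊖ ∷ ⊖ ∷ ⊖ ∷ ⊖ ∷ ⊖ ∷ ⊖ ∷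
         ⊖ ∷ ⊕ ∷ ⊕ ∷ ⊖ ∷ ⊖ ∷ ⊖ ∷ ⊕ ∷ ⊕ ∷ ⊕ ∷ ⊖ ∷ ⊖ ∷ ⊖ ∷ ⊖ ∷ ⊖ ∷ ⊖ ∷ ⊖ ∷ ⊖ ∷ ⊕ ∷ ⊕ ∷ ⊕ ∷ ⊖ ∷ ⊖ ∷ ⊕ ∷ ⊖ ∷ ⊖ ∷ []

a b : Fin 50 → ℤ
a = fromSigns signsA
b = fromSigns signsB

CancelsAt : ℕ → Set
CancelsAt i = paf a i +ℤ paf b i ≡ + 0

cancelsAt? : (i : ℕ) → Dec (CancelsAt i)
cancelsAt? i = paf a i +ℤ paf b i ≟ + 0

cancelsAt-nonzero-shifts : (k : Fin 49) → CancelsAt (suc (toℕ k))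
cancelsAt-nonzero-shifts = toWitness {a? = all? (λ k → cancelsAt? (suc (toℕ k)))} _

mainTheorem9 : Σ (Fin 50 → ℤ) λ a → Σ (Fin 50 → ℤ) λ b →
    IsPM1 a × IsPM1 b ×
    ((i : ℕ) → 1 ≤ i → i ≤ 49 → paf a i +ℤ paf b i ≡ + 0)
mainTheorem9 = a , b , fromSigns-isPM1 signsA , fromSigns-isPM1 signsB , shifts
  where
  shifts : (i : ℕ) → 1 ≤ i → i ≤ 49 → CancelsAt i
  shifts (suc k) _ k<49 = fromFin-< (λ k → CancelsAt (suc k)) cancelsAt-nonzero-shifts k<49
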